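{- Let $\mathsf L\in\{\mathsf L_\Diamond,\mathsf L^\forall_\Diamond\}$, let $\mathcal A,\mathcal B$ be classes of frames, let $\mu:\mathsf L\to\mathbb N$ be any complexity measure, and let $m\in\mathbb N$. Then the following are equivalent: (1) Hercules has a winning strategy for the $(\mathsf L,\langle\mathcal A,\mathcal B\rangle)$ formula-complexity game on frames with $\mu$ below $m$; (2) there is an $\mathsf L$-formula $\varphi$ with $\mu(\varphi)<m$ that is valid on every frame of $\mathcal A$ and not valid on any frame of $\mathcal B$.
   Context: Fix a countably infinite set $P$ of propositional variables. $\mathsf L^\forall_\Diamond$ is the set of negation-normal-form formulas built from literals $p,\overline p$ ($p\in P$), $\bot,\top$ with $\vee,\wedge,\Diamond,\Box,\exists,\forall$ (universal modalities); $\mathsf L_\Diamond$ is the fragment without $\exists,\forall$. A frame is $(W,R)$, $W\neq\emptyset$, $R\subseteq W\times W$; a model based on it adds $V:W\to2^P$; pointed models $(\mathcal M,a)$; standard Kripke semantics; a formula is valid on a frame if true at all points under all valuations. For $\mathbf a=(\mathcal M,a)$: $\Box\mathbf a=\{(\mathcal M,b):aRb\}$, $\forall\mathbf a=\{(\mathcal M,b):b\in W\}$. Game on models $(\mathsf L,\langle\mathcal C,\mathcal D\rangle)$ (classes of pointed models): Hercules and the Hydra build a tree whose nodes $\eta$ carry a pair $\langle\mathfrak L(\eta),\mathfrak R(\eta)\rangle$ and a symbol; the root is labelled $\langle\mathcal C,\mathcal D\rangle$ and is a head. While heads remain, Hercules picks a head $\eta$ and plays: Literal $\iota$ with $\mathfrak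 L(\eta)\models\iota$, $\mathfrak R(\eta)\models\neg\iota$ (stub); $\bot$ if $\mathfrak L(\eta)=\emptyset$ (stub); $\top$ if $\mathfrak R(\eta)=\emptyset$ (stub); $\vee$: split $\mathfrak L(\eta)=\mathcal L_1\cup\mathcal L_2$, daughter heads $\langle\mathcal L_i,\mathfrak R(\eta)\rangle$; $\wedge$: split $\mathfrak R(\eta)=\mathcal R_1\cup\mathcal R_2$, daughters $\langle\mathfrak L(\eta),\mathcal R_i\rangle$; $\Diamond$: Hercules picks one element of $\Box\mathbf l$ for each $\mathbf l\in\mathfrak L(\eta)$ (impossible if one is empty), the Hydra picks a subset of $\Box\mathbf r$ for each $\mathbf r\in\mathfrak R(\eta)$, giving one daughter head; $\Box$: dual (Hercules chooses for the right side, the Hydra subsets for the left); $\exists,\forall$ (only in $\mathsf L^\forall_\Diamond$): as $\Diamond,\Box$ with $\forall\mathbf a$ instead of $\Box\mathbf a$. The game ends when no heads remain, with closed tree $T$; $\psi_T$ is the formula whose syntax tree is $T$, $\mu(T)=\mu(\psi_T)$. Game on frames $(\mathsf L,\langle\mathcal A,\mathcal B\rangle)$: first Hercules chooses, for each $\mathcal F\in\mathcal B$, a model based on $\mathcal F$ and a point in it, forming a class $\mathcal B'$ of pointed models; then the Hydra chooses an arbitrary class $\mathcal A'$ of pointed models each based on some frame of $\mathcal A$; then they play the game on models $(\mathsf L,\langle\mathcal A',\mathcal B'\rangle)$, whose tree is the tree of the match. Hercules has a winning strategy with $\mu$ below $m$ if, however the Hydra plays, the match terminates in finite time with a closed tree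 $T$ with $\mu(T)<m$. -}

module Defs where

open import Level using (Level; 0ℓ) renaming (suc to lsuc)
open import Data.Nat using (ℕ; _<_)
open import Data.Bool using (Bool; true; false)
open import Data.Empty using (⊥)
open import Data.Unit using (⊤)
open import Data.Product using (Σ; Σ-syntax; _×_; _,_; proj₁; proj₂)
open import Data.Sum using (_⊎_)
open import Relation.Nullary using (¬_)
open import Relation.Binary.PropositionalEquality using (_≡_)

-- basic = L_◇ ,  withU = L^∀_◇
data Lang : Set where
  basic withU : Lang

data Lit : Set where
  pos : ℕ → Lit
  neg : ℕ → Lit

data Form : Lang → Set where
  lit  : ∀ {ℒ} → Lit → Form ℒ
  ⊥f   : ∀ {ℒ} → Form ℒ
  ⊤f   : ∀ {ℒ} → Form ℒ
  _∨f_ : ∀ {ℒ} → Form ℒ → Form ℒ → Form ℒ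
  _∧f_ : ∀ {ℒ} → Form ℒ → Form ℒ → Form ℒ
  ◇f   : ∀ {ℒ} → Form ℒ → Form ℒ
  □f   : ∀ {ℒ} → Form ℒ → Form ℒ
  ∃f   : Form withU → Form withU
  ∀f   : Form withU → Form withU

record Frame : Set₁ where
  constructor mkFrame
  field
    W : Set
    R : W → W → Set
    inhabited : W

record Model : Set₁ where
  constructor mkModel
  field
    frame : Frame
    V     : Frame.W frame → ℕ → Bool
  open Frame frame public

record PModel : Set₁ where
  constructor mkPM
  field
    model : Model
    pt    : Model.W model

open PModel public

Sat : ∀ {ℒ} (M : Model) → Model.W M → Form ℒ → Set
Sat M w (lit (pos p)) = Model.V M w p ≡ true
Sat M w (lit (neg p)) = Model.V M w p ≡ false
Sat M w ⊥f = ⊥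
Sat M w ⊤f = ⊤
Sat M w (φ ∨f ψ) = Sat M w φ ⊎ Sat M w ψ
Sat M w (φ ∧f ψ) = Sat M w φ × Sat M w ψ
Sat M w (◇f φ) = Σ[ v ∈ Model.W M ] (Model.R M w v × Sat M v φ)
Sat M w (□f φ) = ∀ v → Model.R M w v → Sat M v φ
Sat M w (∃f φ) = Σ[ v ∈ Model.W M ] Sat M v φ
Sat M w (∀f φ) = ∀ v → Sat M v φ

_⊨_ : ∀ {ℒ} → PModel → Form ℒ → Set
a ⊨ φ = Sat (model a) (pt a) φ

ValidOn : ∀ {ℒ} → Frame → Form ℒ → Set
ValidOn F φ = (V : Frame.W F → ℕ → Bool) (w : Frame.W F) → Sat (mkModel F V) w φ

FrameClass : Set₂
FrameClass = Frame → Set₁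

Class : Set₂
Class = PModel → Set₁

_⊆_ : Class → Class → Set₁
C ⊆ D = ∀ a → C a → D a

IsUnion : Class → Class → Class → Set₁
IsUnion C C₁ C₂ = (∀ a → C a → C₁ a ⊎ C₂ a) × (C₁ ⊆ C) × (C₂ ⊆ C)

BoxOf : PModel → Class
BoxOf a p = Σ[ b ∈ Model.W (model a) ] (Model.R (model a) (pt a) b × p ≡ mkPM (model a) b)

AllOf : PModel → Class
AllOf a p = Σ[ b ∈ Model.W (model a) ] (p ≡ mkPM (model a) b)

Image : (C : Class) → ((a : PModel) → C a → PModel) → Class
Image C f p = Σ[ a ∈ PModel ] Σ[ h ∈ C a ] (p ≡ f a h)

BigUnion : (C : Class) → ((a : PModel) → C a → Class) → Class
BigUnion C S p = Σ[ a ∈ PModel ] Σ[ h ∈ C a ] S a h p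

-- A strategy is a well-founded tree: Hercules' moves are data, the
-- Hydra's moves are quantified over (so every match is finite).

data Strat : Lang → Class → Class → Set₂ where
  litM : ∀ {ℒ L R} (ι : Lit) →
         (∀ l → L l → l ⊨ lit {ℒ} ι) → (∀ r → R r → ¬ (r ⊨ lit {ℒ} ι)) →
         Strat ℒ L R
  ⊥M   : ∀ {ℒ L R} → (∀ l → ¬ L l) → Strat ℒ L R
  ⊤M   : ∀ {ℒ L R} → (∀ r → ¬ R r) → Strat ℒ L R
  ∨M   : ∀ {ℒ L R} (L₁ L₂ : Class) → IsUnion L L₁ L₂ →
         Strat ℒ L₁ R → Strat ℒ L₂ R → Strat ℒ L R
  ∧M   : ∀ {ℒ L R} (R₁ R₂ : Class) → IsUnion R R₁ R₂ →
         Strat ℒ L R₁ → Strat ℒ L R₂ → Strat ℒ L R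
  ◇M   : ∀ {ℒ L R} (f : (l : PModel) → L l → PModel) →
         (∀ l h → BoxOf l (f l h)) →
         ((S : (r : PModel) → R r → Class) → (∀ r h → S r h ⊆ BoxOf r) →
            Strat ℒ (Image L f) (BigUnion R S)) →
         Strat ℒ L R
  □M   : ∀ {ℒ L R} (g : (r : PModel) → R r → PModel) →
         (∀ r h → BoxOf r (g r h)) →
         ((S : (l : PModel) → L l → Class) → (∀ l h → S l h ⊆ BoxOf l) →
            Strat ℒ (BigUnion L S) (Image R g)) →
         Strat ℒ L R
  ∃M   : ∀ {L R} (f : (l : PModel) → L l → PModel) →
         (∀ l h → AllOf l (f l h)) →
         ((S : (r : PModel) → R r → Class) → (∀ r h → S r h ⊆ AllOf r) →
            Strat withU (Image L f) (BigUnion R S)) →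
         Strat withU L R
  ∀M   : ∀ {L R} (g : (r : PModel) → R r → PModel) →
         (∀ r h → AllOf r (g r h)) →
         ((S : (l : PModel) → L l → Class) → (∀ l h → S l h ⊆ AllOf l) →
            Strat withU (BigUnion L S) (Image R g)) →
         Strat withU L R

Play : ∀ {ℒ L R} → Strat ℒ L R → Set₂
Play (litM _ _ _) = Data.Unit.Polymorphic.⊤
  where import Data.Unit.Polymorphic
Play (⊥M _) = Data.Unit.Polymorphic.⊤
  where import Data.Unit.Polymorphic
Play (⊤M _) = Data.Unit.Polymorphic.⊤
  where import Data.Unit.Polymorphic
Play (∨M _ _ _ s t) = Play s × Play t
Play (∧M _ _ _ s t) = Play s × Play t
Play {R = R} (◇M f _ k) = Σ[ S ∈ ((r : PModel) → R r → Class) ] Σ[ hS ∈ (∀ r h → S r h ⊆ BoxOf r) ] Play (k S hS)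
Play {L = L} (□M g _ k) = Σ[ S ∈ ((l : PModel) → L l → Class) ] Σ[ hS ∈ (∀ l h → S l h ⊆ BoxOf l) ] Play (k S hS)
Play {R = R} (∃M f _ k) = Σ[ S ∈ ((r : PModel) → R r → Class) ] Σ[ hS ∈ (∀ r h → S r h ⊆ AllOf r) ] Play (k S hS)
Play {L = L} (∀M g _ k) = Σ[ S ∈ ((l : PModel) → L l → Class) ] Σ[ hS ∈ (∀ l h → S l h ⊆ AllOf l) ] Play (k S hS)

-- ψ_T : the formula whose syntax tree is the closed tree T of the match
ψ : ∀ {ℒ L R} (s : Strat ℒ L R) → Play s → Form ℒ
ψ (litM ι _ _) _ = lit ι
ψ (⊥M _) _ = ⊥f
ψ (⊤M _) _ = ⊤f
ψ (∨M _ _ _ s t) (π , ρ) = ψ s π ∨f ψ t ρ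
ψ (∧M _ _ _ s t) (π , ρ) = ψ s π ∧f ψ t ρ
ψ (◇M _ _ k) (S , hS , π) = ◇f (ψ (k S hS) π)
ψ (□M _ _ k) (S , hS , π) = □f (ψ (k S hS) π)
ψ (∃M _ _ k) (S , hS , π) = ∃f (ψ (k S hS) π)
ψ (∀M _ _ k) (S , hS , π) = ∀f (ψ (k S hS) π)

WinsBelow : ∀ {ℒ L R} → (Form ℒ → ℕ) → ℕ → Strat ℒ L R → Set₂
WinsBelow μ m s = ∀ π → μ (ψ s π) < m

-- Hercules' first move: for each F ∈ B a model on F and a point
BChoice : FrameClass → Set₁
BChoice B = (F : Frame) → B F → Σ[ V ∈ (Frame.W F → ℕ → Bool) ] Frame.W F

B′ : (B : FrameClass) → BChoice B → Class
B′ B ch p = Σ[ F ∈ Frame ] Σ[ h ∈ B F ]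
              (p ≡ mkPM (mkModel F (proj₁ (ch F h))) (proj₂ (ch F h)))

-- Hydra's move: a class A' of pointed models each based on a frame of A
BasedOn : FrameClass → Class → Set₁
BasedOn A A′ = ∀ p → A′ p → A (Model.frame (model p))

HerculesWinsFrames : (ℒ : Lang) → FrameClass → FrameClass → (Form ℒ → ℕ) → ℕ → Set₂
HerculesWinsFrames ℒ A B μ m =
  Σ[ ch ∈ BChoice B ] ((A′ : Class) → BasedOn A A′ →
     Σ[ s ∈ Strat ℒ A′ (B′ B ch) ] WinsBelow μ m s)

Separates : (ℒ : Lang) → FrameClass → FrameClass → (Form ℒ → ℕ) → ℕ → Set₁
Separates ℒ A B μ m =
  Σ[ φ ∈ Form ℒ ] (μ φ < m
    × (∀ F → A F → ValidOn F φ)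
    × (∀ F → B F → ¬ ValidOn F φ))

module Submission where

open import Defs
open import Data.Nat using (ℕ; _<_)
open import Axiom.ExcludedMiddle using (ExcludedMiddle)
open import Axiom.DoubleNegationElimination using (em⇒dne)
open import Level using (0ℓ; Lift; lift; lower) renaming (suc to lsuc)
open import Data.Product using (_×_; Σ-syntax; ∃; _,_; proj₁; proj₂)
open import Data.Sum using (_⊎_; inj₁; inj₂; [_,_])
open import Data.Empty using (⊥-elim)
open import Data.Unit using (tt)
open import Data.Bool using (Bool)
open import Relation.Nullary using (¬_; yes; no)
open import Relation.Binary.PropositionalEquality using (_≡_; refl; sym; subst; cong; cong₂)

-- Everything reduces to the game on models, where a formula
-- φ SEPARATES a pair ⟨L,R⟩ of classes of pointed models if it is true on
-- every member of L and false on every member of R.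
--
-- * Soundness: against any strategy the Hydra may always answer with the
--   largest possible sets of successors (the "maximal play"); the formula
--   ψ_T of the resulting closed tree then separates ⟨L,R⟩.  The modal moves need excluded
--   middle to pick the successors refuting a box (or universal) formula.
--
-- On frames, the Hydra's strongest first move is the class of all pointed
-- models on frames of A, and Hercules' first move picks a countermodel on
-- every frame of B; with these, separation on models and condition (2)
-- coincide, which gives both directions of the theorem.

SeparatedBy : ∀ {ℒ} → Form ℒ → Class → Class → Set₁
SeparatedBy φ L R = (∀ l → L l → l ⊨ φ) × (∀ r → R r → ¬ (r ⊨ φ))

transport : ∀ {ℒ} {p q : PModel} (φ : Form ℒ) → p ≡ q → p ⊨ φ → q ⊨ φ
transport φ = subst (_⊨ φ)

-- The Hydra's maximal answer to a modal move: all successors (resp. worlds).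
allBox : (C : Class) → (a : PModel) → C a → Class
allBox C a _ = BoxOf a

allWorlds : (C : Class) → (a : PModel) → C a → Class
allWorlds C a _ = AllOf a

module Soundness {L R : Class} where

  ∨-sound : ∀ {ℒ} {L₁ L₂} {φ χ : Form ℒ} → IsUnion L L₁ L₂ →
    SeparatedBy φ L₁ R → SeparatedBy χ L₂ R → SeparatedBy (φ ∨f χ) L R
  ∨-sound (cover , _ , _) (sat₁ , unsat₁) (sat₂ , unsat₂) =
    (λ l h → [ (λ h₁ → inj₁ (sat₁ l h₁)) , (λ h₂ → inj₂ (sat₂ l h₂)) ] (cover l h)) ,
    (λ r h → [ unsat₁ r h , unsat₂ r h ])

  ∧-sound : ∀ {ℒ} {R₁ R₂} {φ χ : Form ℒ} → IsUnion R R₁ R₂ →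
    SeparatedBy φ L R₁ → SeparatedBy χ L R₂ → SeparatedBy (φ ∧f χ) L R
  ∧-sound (cover , _ , _) (sat₁ , unsat₁) (sat₂ , unsat₂) =
    (λ l h → sat₁ l h , sat₂ l h) ,
    (λ r h (s₁ , s₂) → [ (λ h₁ → unsat₁ r h₁ s₁) , (λ h₂ → unsat₂ r h₂ s₂) ] (cover r h))

  -- The successor chosen by Hercules witnesses ◇φ on the left; any
  -- successor of a right model is among the Hydra's choices, so refutes φ.
  ◇-sound : ∀ {ℒ} {φ : Form ℒ} (f : (l : PModel) → L l → PModel) →
    (∀ l h → BoxOf l (f l h)) →
    SeparatedBy φ (Image L f) (BigUnion R (allBox R)) → SeparatedBy (◇f φ) L R
  ◇-sound {φ = φ} f succ (sat , unsat) =
    (λ l h → let (v , Rv , eq) = succ l h in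
             v , Rv , transport φ eq (sat (f l h) (l , h , refl))) ,
    (λ r h (v , Rv , s) → unsat (mkPM (model r) v) (r , h , v , Rv , refl) s)

  □-sound : ∀ {ℒ} {φ : Form ℒ} (g : (r : PModel) → R r → PModel) →
    (∀ r h → BoxOf r (g r h)) →
    SeparatedBy φ (BigUnion L (allBox L)) (Image R g) → SeparatedBy (□f φ) L R
  □-sound {φ = φ} g succ (sat , unsat) =
    (λ l h v Rv → sat (mkPM (model l) v) (l , h , v , Rv , refl)) ,
    (λ r h s → let (v , Rv , eq) = succ r h in
               unsat (g r h) (r , h , refl) (transport φ (sym eq) (s v Rv)))

  ∃-sound : ∀ {φ : Form withU} (f : (l : PModel) → L l → PModel) →
    (∀ l h → AllOf l (f l h)) →
    SeparatedBy φ (Image L f) (BigUnion R (allWorlds R)) → SeparatedBy (∃f φ) L R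
  ∃-sound {φ} f world (sat , unsat) =
    (λ l h → let (v , eq) = world l h in
             v , transport φ eq (sat (f l h) (l , h , refl))) ,
    (λ r h (v , s) → unsat (mkPM (model r) v) (r , h , v , refl) s)

  ∀-sound : ∀ {φ : Form withU} (g : (r : PModel) → R r → PModel) →
    (∀ r h → AllOf r (g r h)) →
    SeparatedBy φ (BigUnion L (allWorlds L)) (Image R g) → SeparatedBy (∀f φ) L R
  ∀-sound {φ} g world (sat , unsat) =
    (λ l h v → sat (mkPM (model l) v) (l , h , v , refl)) ,
    (λ r h s → let (v , eq) = world r h in
               unsat (g r h) (r , h , refl) (transport φ (sym eq) (s v)))

maximalPlay : ∀ {ℒ L R} (s : Strat ℒ L R) → Play s
maximalPlay (litM _ _ _) = _
maximalPlay (⊥M _) = _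
maximalPlay (⊤M _) = _
maximalPlay (∨M _ _ _ s t) = maximalPlay s , maximalPlay t
maximalPlay (∧M _ _ _ s t) = maximalPlay s , maximalPlay t
maximalPlay {R = R} (◇M _ _ k) = allBox R , (λ _ _ _ x → x) , maximalPlay (k _ _)
maximalPlay {L = L} (□M _ _ k) = allBox L , (λ _ _ _ x → x) , maximalPlay (k _ _)
maximalPlay {R = R} (∃M _ _ k) = allWorlds R , (λ _ _ _ x → x) , maximalPlay (k _ _)
maximalPlay {L = L} (∀M _ _ k) = allWorlds L , (λ _ _ _ x → x) , maximalPlay (k _ _)

maximalPlay-separates : ∀ {ℒ L R} (s : Strat ℒ L R) →
  SeparatedBy (ψ s (maximalPlay s)) L R
maximalPlay-separates (litM ι sat unsat) = sat , unsat
maximalPlay-separates (⊥M noL) = (λ l h → noL l h) , (λ _ _ ())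
maximalPlay-separates (⊤M noR) = (λ _ _ → tt) , (λ r h _ → noR r h)
maximalPlay-separates (∨M _ _ u s t) =
  Soundness.∨-sound u (maximalPlay-separates s) (maximalPlay-separates t)
maximalPlay-separates (∧M _ _ u s t) =
  Soundness.∧-sound u (maximalPlay-separates s) (maximalPlay-separates t)
maximalPlay-separates (◇M f succ k) =
  Soundness.◇-sound f succ (maximalPlay-separates (k _ _))
maximalPlay-separates (□M g succ k) =
  Soundness.□-sound g succ (maximalPlay-separates (k _ _))
maximalPlay-separates (∃M f world k) =
  Soundness.∃-sound f world (maximalPlay-separates (k _ _))
maximalPlay-separates (∀M g world k) =
  Soundness.∀-sound g world (maximalPlay-separates (k _ _))

-- The Hydra's strongest first move: all pointed models on frames of A.
modelsOn : FrameClass → Class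
modelsOn A p = A (Model.frame (model p))

valid⇒true : ∀ {ℒ A A′} {φ : Form ℒ} →
  (∀ F → A F → ValidOn F φ) → BasedOn A A′ → ∀ l → A′ l → l ⊨ φ
valid⇒true valid based l h = valid _ (based l h) (Model.V (model l)) (pt l)

true⇒valid : ∀ {ℒ A} {φ : Form ℒ} →
  (∀ l → modelsOn A l → l ⊨ φ) → ∀ F → A F → ValidOn F φ
true⇒valid sat F h V w = sat (mkPM (mkModel F V) w) h

refuted⇒invalid : ∀ {ℒ B} {φ : Form ℒ} (ch : BChoice B) →
  (∀ r → B′ B ch r → ¬ (r ⊨ φ)) → ∀ F → B F → ¬ ValidOn F φ
refuted⇒invalid ch refutes F h valid =
  refutes _ (F , h , refl) (valid (proj₁ (ch F h)) (proj₂ (ch F h)))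

-- Direction (1) ⇒ (2): the Hydra answers with all models on A and then
-- plays maximally; the resulting formula separates A from B.
winning⇒separating : ∀ {ℒ A B μ m} → HerculesWinsFrames ℒ A B μ m → Separates ℒ A B μ m
winning⇒separating {A = A} (ch , respond) =
  let (s , win) = respond (modelsOn A) (λ _ h → h)
      (sat , refutes) = maximalPlay-separates s
  in ψ s (maximalPlay s) , win (maximalPlay s) ,
     true⇒valid sat , refuted⇒invalid ch refutes

_∩_ : Class → (PModel → Set) → Class
(C ∩ P) p = C p × Lift (lsuc 0ℓ) (P p)

cover : ∀ {C} {P Q : PModel → Set} →
  (∀ p → C p → P p ⊎ Q p) → IsUnion C (C ∩ P) (C ∩ Q)
cover split =
  (λ p h → [ (λ x → inj₁ (h , lift x)) , (λ y → inj₂ (h , lift y)) ] (split p h)) ,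
  (λ _ → proj₁) , (λ _ → proj₁)

module Completeness (em : ExcludedMiddle 0ℓ) where

  ¬∀⇒∃¬ : {X : Set} {P : X → Set} → ¬ (∀ x → P x) → ∃ λ x → ¬ P x
  ¬∀⇒∃¬ ¬all = em⇒dne em λ ¬ex → ¬all λ x → em⇒dne em λ ¬Px → ¬ex (x , ¬Px)

  ¬→⇒×¬ : {P Q : Set} → ¬ (P → Q) → P × ¬ Q
  ¬→⇒×¬ ¬imp = em⇒dne em (λ ¬p → ¬imp λ p → ⊥-elim (¬p p)) , λ q → ¬imp λ _ → q

  ¬×⇒⊎¬ : {P Q : Set} → ¬ (P × Q) → ¬ P ⊎ ¬ Q
  ¬×⇒⊎¬ {P} ¬both with em {P}
  ... | yes p = inj₂ λ q → ¬both (p , q)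
  ... | no ¬p = inj₁ ¬p

  module _ {ℒ : Lang} {L R : Class} where

    ∨-left : {φ χ : Form ℒ} → SeparatedBy (φ ∨f χ) L R → SeparatedBy φ (L ∩ (_⊨ φ)) R
    ∨-left (_ , unsat) = (λ _ h → lower (proj₂ h)) , λ r h s → unsat r h (inj₁ s)

    ∨-right : {φ χ : Form ℒ} → SeparatedBy (φ ∨f χ) L R → SeparatedBy χ (L ∩ (_⊨ χ)) R
    ∨-right (_ , unsat) = (λ _ h → lower (proj₂ h)) , λ r h s → unsat r h (inj₂ s)

    ∧-cover : {φ χ : Form ℒ} → SeparatedBy (φ ∧f χ) L R →
      IsUnion R (R ∩ (λ r → ¬ (r ⊨ φ))) (R ∩ (λ r → ¬ (r ⊨ χ)))
    ∧-cover (_ , unsat) = cover λ r h → ¬×⇒⊎¬ (unsat r h)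

    ∧-left : {φ χ : Form ℒ} → SeparatedBy (φ ∧f χ) L R →
      SeparatedBy φ L (R ∩ (λ r → ¬ (r ⊨ φ)))
    ∧-left (sat , _) = (λ l h → proj₁ (sat l h)) , λ _ h → lower (proj₂ h)

    ∧-right : {φ χ : Form ℒ} → SeparatedBy (φ ∧f χ) L R →
      SeparatedBy χ L (R ∩ (λ r → ¬ (r ⊨ χ)))
    ∧-right (sat , _) = (λ l h → proj₂ (sat l h)) , λ _ h → lower (proj₂ h)

    -- Diamond: Hercules moves each left model to a successor satisfying φ;
    -- whatever successors the Hydra picks on the right, they refute φ.
    ◇-witness : {φ : Form ℒ} → SeparatedBy (◇f φ) L R → (l : PModel) → L l → PModel
    ◇-witness (sat , _) l h = mkPM (model l) (proj₁ (sat l h))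

    ◇-witness-succ : {φ : Form ℒ} (sep : SeparatedBy (◇f φ) L R) →
      ∀ l h → BoxOf l (◇-witness sep l h)
    ◇-witness-succ (sat , _) l h = proj₁ (sat l h) , proj₁ (proj₂ (sat l h)) , refl

    ◇-step : {φ : Form ℒ} (sep : SeparatedBy (◇f φ) L R) →
      (S : (r : PModel) → R r → Class) → (∀ r h → S r h ⊆ BoxOf r) →
      SeparatedBy φ (Image L (◇-witness sep)) (BigUnion R S)
    ◇-step {φ} (sat , unsat) S inBox =
      (λ { _ (l , h , refl) → proj₂ (proj₂ (sat l h)) }) ,
      (λ p (r , h , p∈S) → refuted r h (inBox r h p p∈S))
      where
      refuted : ∀ {p} r → R r → BoxOf r p → ¬ (p ⊨ φ)
      refuted r h (v , Rv , refl) s = unsat r h (v , Rv , s)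

    -- Box: Hercules moves each right model to a successor refuting φ,
    -- which exists by excluded middle.
    □-witness : {φ : Form ℒ} → SeparatedBy (□f φ) L R → (r : PModel) → R r →
      Σ[ v ∈ Model.W (model r) ] (Model.R (model r) (pt r) v × ¬ Sat (model r) v φ)
    □-witness (_ , unsat) r h =
      let (v , ¬imp) = ¬∀⇒∃¬ (unsat r h) in v , ¬→⇒×¬ ¬imp

    □-choice : {φ : Form ℒ} → SeparatedBy (□f φ) L R → (r : PModel) → R r → PModel
    □-choice sep r h = mkPM (model r) (proj₁ (□-witness sep r h))

    □-choice-succ : {φ : Form ℒ} (sep : SeparatedBy (□f φ) L R) →
      ∀ r h → BoxOf r (□-choice sep r h)
    □-choice-succ sep r h = proj₁ (□-witness sep r h) , proj₁ (proj₂ (□-witness sep r h)) , refl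

    □-step : {φ : Form ℒ} (sep : SeparatedBy (□f φ) L R) →
      (S : (l : PModel) → L l → Class) → (∀ l h → S l h ⊆ BoxOf l) →
      SeparatedBy φ (BigUnion L S) (Image R (□-choice sep))
    □-step {φ} sep@(sat , _) S inBox =
      (λ p (l , h , p∈S) → holds l h (inBox l h p p∈S)) ,
      (λ { _ (r , h , refl) → proj₂ (proj₂ (□-witness sep r h)) })
      where
      holds : ∀ {p} l → L l → BoxOf l p → p ⊨ φ
      holds l h (v , Rv , refl) = sat l h v Rv

  module _ {L R : Class} where

    ∃-witness : {φ : Form withU} → SeparatedBy (∃f φ) L R → (l : PModel) → L l → PModel
    ∃-witness (sat , _) l h = mkPM (model l) (proj₁ (sat l h))

    ∃-witness-world : {φ : Form withU} (sep : SeparatedBy (∃f φ) L R) →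
      ∀ l h → AllOf l (∃-witness sep l h)
    ∃-witness-world (sat , _) l h = proj₁ (sat l h) , refl

    ∃-step : {φ : Form withU} (sep : SeparatedBy (∃f φ) L R) →
      (S : (r : PModel) → R r → Class) → (∀ r h → S r h ⊆ AllOf r) →
      SeparatedBy φ (Image L (∃-witness sep)) (BigUnion R S)
    ∃-step {φ} (sat , unsat) S inAll =
      (λ { _ (l , h , refl) → proj₂ (sat l h) }) ,
      (λ p (r , h , p∈S) → refuted r h (inAll r h p p∈S))
      where
      refuted : ∀ {p} r → R r → AllOf r p → ¬ (p ⊨ φ)
      refuted r h (v , refl) s = unsat r h (v , s)

    ∀-choice : {φ : Form withU} → SeparatedBy (∀f φ) L R → (r : PModel) → R r → PModel
    ∀-choice (_ , unsat) r h = mkPM (model r) (proj₁ (¬∀⇒∃¬ (unsat r h)))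

    ∀-choice-world : {φ : Form withU} (sep : SeparatedBy (∀f φ) L R) →
      ∀ r h → AllOf r (∀-choice sep r h)
    ∀-choice-world (_ , unsat) r h = proj₁ (¬∀⇒∃¬ (unsat r h)) , refl

    ∀-step : {φ : Form withU} (sep : SeparatedBy (∀f φ) L R) →
      (S : (l : PModel) → L l → Class) → (∀ l h → S l h ⊆ AllOf l) →
      SeparatedBy φ (BigUnion L S) (Image R (∀-choice sep))
    ∀-step {φ} (sat , unsat) S inAll =
      (λ p (l , h , p∈S) → holds l h (inAll l h p p∈S)) ,
      (λ { _ (r , h , refl) → proj₂ (¬∀⇒∃¬ (unsat r h)) })
      where
      holds : ∀ {p} l → L l → AllOf l p → p ⊨ φ
      holds l h (v , refl) = sat l h v

  strategyFor : ∀ {ℒ L R} (φ : Form ℒ) → SeparatedBy φ L R → Strat ℒ L R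
  strategyFor (lit ι) (sat , unsat) = litM ι sat unsat
  strategyFor ⊥f (sat , _) = ⊥M sat
  strategyFor ⊤f (_ , unsat) = ⊤M λ r h → unsat r h tt
  strategyFor (φ ∨f χ) sep@(sat , _) =
    ∨M _ _ (cover sat) (strategyFor φ (∨-left sep)) (strategyFor χ (∨-right sep))
  strategyFor (φ ∧f χ) sep =
    ∧M _ _ (∧-cover sep) (strategyFor φ (∧-left sep)) (strategyFor χ (∧-right sep))
  strategyFor (◇f φ) sep =
    ◇M (◇-witness sep) (◇-witness-succ sep) λ S inBox → strategyFor φ (◇-step sep S inBox)
  strategyFor (□f φ) sep =
    □M (□-choice sep) (□-choice-succ sep) λ S inBox → strategyFor φ (□-step sep S inBox)
  strategyFor (∃f φ) sep =
    ∃M (∃-witness sep) (∃-witness-world sep) λ S inAll → strategyFor φ (∃-step sep S inAll)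
  strategyFor (∀f φ) sep =
    ∀M (∀-choice sep) (∀-choice-world sep) λ S inAll → strategyFor φ (∀-step sep S inAll)

  strategyFor-yields : ∀ {ℒ L R} (φ : Form ℒ) (sep : SeparatedBy φ L R)
    (π : Play (strategyFor φ sep)) → ψ (strategyFor φ sep) π ≡ φ
  strategyFor-yields (lit ι) _ _ = refl
  strategyFor-yields ⊥f _ _ = refl
  strategyFor-yields ⊤f _ _ = refl
  strategyFor-yields (φ ∨f χ) _ (π , ρ) =
    cong₂ _∨f_ (strategyFor-yields φ _ π) (strategyFor-yields χ _ ρ)
  strategyFor-yields (φ ∧f χ) _ (π , ρ) =
    cong₂ _∧f_ (strategyFor-yields φ _ π) (strategyFor-yields χ _ ρ)
  strategyFor-yields (◇f φ) _ (_ , _ , π) = cong ◇f (strategyFor-yields φ _ π)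
  strategyFor-yields (□f φ) _ (_ , _ , π) = cong □f (strategyFor-yields φ _ π)
  strategyFor-yields (∃f φ) _ (_ , _ , π) = cong ∃f (strategyFor-yields φ _ π)
  strategyFor-yields (∀f φ) _ (_ , _ , π) = cong ∀f (strategyFor-yields φ _ π)

  countermodelChoice : ∀ {ℒ} {B : FrameClass} {φ : Form ℒ} →
    (∀ F → B F → ¬ ValidOn F φ) →
    Σ[ ch ∈ BChoice B ] (∀ r → B′ B ch r → ¬ (r ⊨ φ))
  countermodelChoice {B = B} {φ} invalid = choice , refutes
    where
    counterexample : (F : Frame) → B F → Σ[ V ∈ (Frame.W F → ℕ → Bool) ]
                       Σ[ w ∈ Frame.W F ] ¬ Sat (mkModel F V) w φ
    counterexample F h =
      let (V , ¬allW) = ¬∀⇒∃¬ (invalid F h) in V , ¬∀⇒∃¬ ¬allW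
    choice : BChoice B
    choice F h = proj₁ (counterexample F h) , proj₁ (proj₂ (counterexample F h))
    refutes : ∀ r → B′ B choice r → ¬ (r ⊨ φ)
    refutes _ (F , h , refl) = proj₂ (proj₂ (counterexample F h))

  -- Direction (2) ⇒ (1): Hercules chooses countermodels on B; against any
  -- class based on A, the formula's own strategy wins and yields φ itself.
  separating⇒winning : ∀ {ℒ A B μ m} → Separates ℒ A B μ m → HerculesWinsFrames ℒ A B μ m
  separating⇒winning {μ = μ} {m} (φ , small , valid , invalid) =
    let (ch , refutes) = countermodelChoice invalid in
    ch , λ A′ based →
      let s = strategyFor φ (valid⇒true valid based , refutes) in
      s , λ π → subst (λ χ → μ χ < m) (sym (strategyFor-yields φ _ π)) small

theorem4p3 : ExcludedMiddle 0ℓ →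
    (ℒ : Lang) (A B : FrameClass) (μ : Form ℒ → ℕ) (m : ℕ) →
    (HerculesWinsFrames ℒ A B μ m → Separates ℒ A B μ m)
      × (Separates ℒ A B μ m → HerculesWinsFrames ℒ A B μ m)
theorem4p3 em ℒ A B μ m = winning⇒separating , Completeness.separating⇒winning em
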